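{- Let $n\ge1$ and let $\mathcal F\subseteq\mathcal P([n])$ be an $\mathcal N$-saturated family. Then $|\mathcal F|\ge \frac{n+6}{4}$.
   Context: $[n]=\{1,\dots,n\}$, $\mathcal P([n])$ is its power set ordered by inclusion. The poset $\mathcal N$ has four elements $a,b,c,d$ with $a<c$, $b<c$, $b<d$ and no other comparabilities. A family $\mathcal F\subseteq\mathcal P([n])$ contains an induced copy of $\mathcal N$ if there are distinct $P,Q,R,S\in\mathcal F$ with $P\subset R$, $Q\subset R$, $Q\subset S$, and such that each of the pairs $\{P,Q\}$, $\{P,S\}$, $\{R,S\}$ is incomparable under inclusion. $\mathcal F$ is $\mathcal N$-saturated if $\mathcal F$ contains no induced copy of $\mathcal N$, but for every $X\in\mathcal P([n])\setminus\mathcal F$ the family $\mathcal F\cup\{X\}$ contains an induced copy of $\mathcal N$. -}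

module Defs where

open import Data.Nat using (ℕ)
open import Data.Product using (Σ; _×_; ∃)
open import Data.List using (List; _∷_)
open import Data.List.Membership.Propositional using () renaming (_∈_ to _∈ₗ_; _∉_ to _∉ₗ_)
open import Data.Fin.Subset using (Subset; _⊆_; _⊂_)
open import Relation.Nullary using (¬_)
open import Relation.Binary.PropositionalEquality using (_≡_; _≢_)

-- A family of subsets of [n] = Fin n is represented as a list of
-- subsets (Subset n); |F| is its length, required duplicate-free
-- (see Data.List.Relation.Unary.Unique in the statement).
Family : ℕ → Set
Family n = List (Subset n)

Incomparable : ∀ {n} → Subset n → Subset n → Set
Incomparable P Q = ¬ (P ⊆ Q) × ¬ (Q ⊆ P)

InducedN : ∀ {n} → Subset n → Subset n → Subset n → Subset n → Set
InducedN P Q R S =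
  P ≢ Q × P ≢ R × P ≢ S × Q ≢ R × Q ≢ S × R ≢ S ×
  P ⊂ R × Q ⊂ R × Q ⊂ S ×
  Incomparable P Q × Incomparable P S × Incomparable R S

ContainsInducedN : ∀ {n} → Family n → Set
ContainsInducedN {n} F =
  Σ (Subset n) λ P → Σ (Subset n) λ Q → Σ (Subset n) λ R → Σ (Subset n) λ S →
    P ∈ₗ F × Q ∈ₗ F × R ∈ₗ F × S ∈ₗ F × InducedN P Q R S

_∷F_ : ∀ {n} → Subset n → Family n → Family n
X ∷F F = X ∷ F

NSaturated : ∀ {n} → Family n → Set
NSaturated {n} F =
  ¬ ContainsInducedN F ×
  (∀ (X : Subset n) → X ∉ₗ F → ContainsInducedN (X ∷F F))

-- In fact n + 2 ≤ 2 |F|. Two facts about a saturated F drive the proof. First, ∅, [n] ∈ F, as a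
-- set comparable to every set lies in no induced N. Second, no two elements of N relate alike to
-- the other two; so if X relates to every member of F other than A ∈ F exactly as A does, then
-- X ∈ F, because a copy of N in F ∪ {X} through X would survive replacing X by A.
--
-- Climb a maximal chain ∅ = C₀ ⋖ C₁ ⋖ ⋯ ⋖ Cₖ = [n] of members of F. Each j ∈ Cᵢ ∖ Cᵢ₋₁ is
-- charged to a member Z with Z ⊆ Cᵢ and Z ∖ Cᵢ₋₁ = {j}, or with Cᵢ₋₁ ⊆ Z and Cᵢ ∖ Z = {j}.
-- Unless Z = Cᵢ does, Cᵢ₋₁ ∪ {j} and Cᵢ ∖ {j} lie strictly between Cᵢ₋₁ and Cᵢ, hence outside F,
-- so some member of F separates Cᵢ₋₁ ∪ {j} from Cᵢ₋₁, and some separates Cᵢ ∖ {j} from Cᵢ. If a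
-- member G ⊃ Cᵢ₋₁ incomparable to Cᵢ misses j, the latter separator is a charge (any other kind
-- of separator would form an N with Cᵢ₋₁, Cᵢ and G); otherwise the former is. Tagged "Z ⊆ Cᵢ" or
-- "Cᵢ ⊈ Z", charges are distinct across all levels and Z ≠ ∅, whence n ≤ 2 (|F| − 1).

module Submission where

open import Defs
open import Data.Nat using (ℕ; zero; suc; _≤_; _<_; _*_; _+_)
open import Data.List using (length)
open import Data.List.Relation.Unary.Unique.Propositional using (Unique)

open import Data.Bool using (Bool; true; false; T)
import Data.Bool as Bool
open import Data.Bool.Properties using (T?)
open import Data.Empty using (⊥-elim)
open import Data.Fin using (Fin; zero; suc; _≟_)
open import Data.Fin.Patterns using (0F; 1F; 2F; 3F)
import Data.Fin.Properties as Fin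
open import Data.Fin.Subset using (Subset; _∈_; _∉_; _⊆_; _⊂_; ⊥; ⊤; ⁅_⁆; _∪_; _-_; Nonempty; Empty)
open import Data.Fin.Subset.Properties
  using (_∈?_; _⊆?_; _⊂?_; nonempty?; ⊆-refl; ⊆-reflexive; ⊆-trans; ⊆-antisym; ⊂-trans; ⊂-irref;
         ⊥⊆; ⊆⊤; ∉⊥; ∈⊤; p⊆p∪q; x∈p∪q⁺; x∈p∪q⁻; x∈⁅x⁆; x∈⁅y⁆⇒x≡y; p─q⊆p; x∈p∧x≢y⇒x∈p-y)
open import Data.Fin.Subset.Induction using (⊂-wellFounded)
open import Data.List using (List; []; _∷_; _++_; map; filter; cartesianProduct)
import Data.List as List
open import Data.List.Properties using (length-++; length-map; filter-notAll)
open import Data.List.Membership.Propositional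
  using (find; lose) renaming (_∈_ to _∈ₗ_; _∉_ to _∉ₗ_)
open import Data.List.Membership.Propositional.Properties using (∈-filter⁺; ∈-cartesianProduct⁺)
open import Data.List.Relation.Unary.Any as Any using (Any; here; there)
open import Data.List.Relation.Unary.Any.Properties using (lookup-index)
open import Data.Nat.Properties using (≤-trans; +-monoˡ-≤; *-monoʳ-≤; m≤m+n; module ≤-Reasoning)
open import Data.Nat.Solver using (module +-*-Solver)
open import Data.Product using (∃; _×_; _,_; proj₁; proj₂)
open import Data.Sum using (_⊎_; inj₁; inj₂; [_,_])
import Data.Sum as Sum
open import Data.Vec using (_∷_; []; there; lookup)
open import Data.Vec.Properties using (≡-dec)
open import Function using (_∘_; _⇔_; mk⇔; Equivalence)
open import Function.Construct.Composition using (_⇔-∘_)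
open import Function.Construct.Identity using (⇔-id)
open import Function.Construct.Symmetry using (⇔-sym)
open import Function.Definitions using (Injective)
open import Induction.WellFounded using (Acc; acc)
open import Relation.Binary.Definitions using (DecidableEquality)
open import Relation.Binary.PropositionalEquality
  using (_≡_; _≢_; refl; sym; subst; cong; module ≡-Reasoning)
open import Relation.Nullary using (¬_; Dec; yes; no; does; contradiction)
open import Relation.Nullary.Decidable
  using (_×-dec_; _⊎-dec_; _→-dec_; ¬?; from-yes; decidable-stable; does-⇔)

open +-*-Solver using (solve; _:+_; _:*_; _:=_; con)
open Equivalence using (to; from)

private
  variable
    n : ℕ
    p q A C X Z : Subset n
    j k x : Fin n

⊈⇒∃∉ : ¬ (p ⊆ q) → ∃ λ x → x ∈ p × x ∉ q
⊈⇒∃∉ {p = p} {q = q} p⊈q with Fin.any? (λ x → x ∈? p ×-dec ¬? (x ∈? q))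
... | yes witness = witness
... | no none = ⊥-elim (p⊈q p⊆q)
  where
  p⊆q : p ⊆ q
  p⊆q {x} x∈p = decidable-stable (x ∈? q) λ x∉q → none (x , x∈p , x∉q)

⊆∧⊉⇒⊂ : p ⊆ q → ¬ (q ⊆ p) → p ⊂ q
⊆∧⊉⇒⊂ p⊆q q⊈p = p⊆q , ⊈⇒∃∉ q⊈p

⊆∧≢⇒⊂ : p ⊆ q → p ≢ q → p ⊂ q
⊆∧≢⇒⊂ p⊆q p≢q = ⊆∧⊉⇒⊂ p⊆q (p≢q ∘ ⊆-antisym p⊆q)

⊂⇒⊉ : p ⊂ q → ¬ (q ⊆ p)
⊂⇒⊉ (_ , x , x∈q , x∉p) q⊆p = x∉p (q⊆p x∈q)

_≟ₛ_ : DecidableEquality (Subset n)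
_≟ₛ_ = ≡-dec Bool._≟_

incomparable⇒≢ : Incomparable p q → p ≢ q
incomparable⇒≢ (p⊈q , _) refl = p⊈q ⊆-refl

x∈p∪⁅y⁆⇒x∈p⊎x≡y : ∀ {y} → x ∈ p ∪ ⁅ y ⁆ → x ∈ p ⊎ x ≡ y
x∈p∪⁅y⁆⇒x∈p⊎x≡y {p = p} {y = y} x∈ with x∈p∪q⁻ p ⁅ y ⁆ x∈
... | inj₁ x∈p = inj₁ x∈p
... | inj₂ x∈⁅y⁆ = inj₂ (x∈⁅y⁆⇒x≡y y x∈⁅y⁆)

p⊆q∧x∈q⇒p∪⁅x⁆⊆q : p ⊆ q → x ∈ q → p ∪ ⁅ x ⁆ ⊆ q
p⊆q∧x∈q⇒p∪⁅x⁆⊆q p⊆q x∈q y∈ with x∈p∪⁅y⁆⇒x∈p⊎x≡y y∈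
... | inj₁ y∈p = p⊆q y∈p
... | inj₂ refl = x∈q

p⊆q∧x∉p⇒p⊆q-x : p ⊆ q → x ∉ p → p ⊆ q - x
p⊆q∧x∉p⇒p⊆q-x {p = p} p⊆q x∉p y∈p = x∈p∧x≢y⇒x∈p-y (p⊆q y∈p) λ { refl → x∉p y∈p }

p-x⊆q∧x∈q⇒p⊆q : p - x ⊆ q → x ∈ q → p ⊆ q
p-x⊆q∧x∈q⇒p⊆q {x = x} p-x⊆q x∈q {y} y∈p with y ≟ x
... | yes refl = x∈q
... | no y≢x = p-x⊆q (x∈p∧x≢y⇒x∈p-y y∈p y≢x)

x∉p-x : ∀ (x : Fin n) → x ∉ p - x
x∉p-x {p = _ ∷ _} zero ()
x∉p-x {p = _ ∷ _} (suc x) (there x∈) = x∉p-x x x∈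

lower-cover : ∀ (L : Family n) → A ⊂ C →
  ∃ λ B → (B ≡ A ⊎ B ∈ₗ L) × B ⊂ C × (∀ {Z} → Z ∈ₗ L → ¬ (B ⊂ Z × Z ⊂ C))
lower-cover [] A⊂C = _ , inj₁ refl , A⊂C , λ ()
lower-cover {C = C} (Z ∷ L) A⊂C with lower-cover L A⊂C
... | B , B∈ , B⊂C , nothing-between with B ⊂? Z ×-dec Z ⊂? C
...   | yes (B⊂Z , Z⊂C) = Z , inj₂ (here refl) , Z⊂C , λ where
          (here refl) (Z⊂Z , _) → ⊂-irref refl Z⊂Z
          (there Y∈L) (Z⊂Y , Y⊂C) → nothing-between Y∈L (⊂-trans B⊂Z Z⊂Y , Y⊂C)
...   | no Z-not-between = B , Sum.map₂ there B∈ , B⊂C , λ where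
          (here refl) → Z-not-between
          (there Y∈L) → nothing-between Y∈L

injective⇒≤-length : ∀ {A : Set} {k} {xs : List A} (f : Fin k → A) → Injective _≡_ _≡_ f →
  (∀ i → f i ∈ₗ xs) → k ≤ length xs
injective⇒≤-length {xs = xs} f f-injective f∈xs = Fin.injective⇒≤ λ {i} {j} same-index →
  f-injective (begin
    f i                                 ≡⟨ lookup-index (f∈xs i) ⟩
    List.lookup xs (Any.index (f∈xs i)) ≡⟨ cong (List.lookup xs) same-index ⟩
    List.lookup xs (Any.index (f∈xs j)) ≡⟨ lookup-index (f∈xs j) ⟨
    f j                                 ∎)
  where open ≡-Reasoning

length-cartesianProduct : ∀ {A B : Set} (xs : List A) (ys : List B) →
  length (cartesianProduct xs ys) ≡ length xs * length ys
length-cartesianProduct []       ys = refl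
length-cartesianProduct (x ∷ xs) ys = begin
  length (map (x ,_) ys ++ cartesianProduct xs ys)         ≡⟨ length-++ (map (x ,_) ys) ⟩
  length (map (x ,_) ys) + length (cartesianProduct xs ys) ≡⟨ cong (_+ _) (length-map (x ,_) ys) ⟩
  length ys + length (cartesianProduct xs ys)              ≡⟨ cong (_ +_) (length-cartesianProduct xs ys) ⟩
  length ys + length xs * length ys                        ∎
  where open ≡-Reasoning

-- The poset N and its induced copies

-- N on Fin 4, with a, b, c, d numbered 0, 1, 2, 3.
infix 5 _≤ᴺ_
_≤ᴺ_ : Fin 4 → Fin 4 → Bool
0F ≤ᴺ 2F = true
1F ≤ᴺ 2F = true
1F ≤ᴺ 3F = true
i  ≤ᴺ j  = does (i ≟ j)

≤ᴺ-antisym : ∀ i j → T (i ≤ᴺ j) → T (j ≤ᴺ i) → i ≡ j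
≤ᴺ-antisym = from-yes (Fin.all? λ i → Fin.all? λ j → T? (i ≤ᴺ j) →-dec T? (j ≤ᴺ i) →-dec i ≟ j)

≤ᴺ-incomparable : ∀ i → ∃ λ j → ¬ T (i ≤ᴺ j) × ¬ T (j ≤ᴺ i)
≤ᴺ-incomparable = from-yes (Fin.all? λ i → Fin.any? λ j → ¬? (T? (i ≤ᴺ j)) ×-dec ¬? (T? (j ≤ᴺ i)))

≤ᴺ-twin-free : ∀ i j → i ≢ j →
  ∃ λ k → k ≢ i × k ≢ j × (k ≤ᴺ i ≢ k ≤ᴺ j ⊎ i ≤ᴺ k ≢ j ≤ᴺ k)
≤ᴺ-twin-free = from-yes (Fin.all? λ i → Fin.all? λ j → ¬? (i ≟ j) →-dec Fin.any? λ k →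
  ¬? (k ≟ i) ×-dec ¬? (k ≟ j) ×-dec (¬? (k ≤ᴺ i Bool.≟ k ≤ᴺ j) ⊎-dec ¬? (i ≤ᴺ k Bool.≟ j ≤ᴺ k)))

IsNCopy : (Fin 4 → Subset n) → Set
IsNCopy v = ∀ i j → v i ⊆ v j ⇔ T (i ≤ᴺ j)

NCopyIn : Family n → Set
NCopyIn {n} F = ∃ λ (v : Fin 4 → Subset n) → IsNCopy v × (∀ i → v i ∈ₗ F)

Indiscernible : Subset n → Subset n → Subset n → Set
Indiscernible Z X Y = (Z ⊆ X ⇔ Z ⊆ Y) × (X ⊆ Z ⇔ Y ⊆ Z)

induced-N : ∀ {P Q R S : Subset n} → P ⊂ R → Q ⊂ R → Q ⊂ S →
  Incomparable P Q → Incomparable P S → Incomparable R S → InducedN P Q R S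
induced-N P⊂R Q⊂R Q⊂S P∥Q P∥S R∥S =
  incomparable⇒≢ P∥Q , (λ P≡R → ⊂-irref P≡R P⊂R) , incomparable⇒≢ P∥S ,
  (λ Q≡R → ⊂-irref Q≡R Q⊂R) , (λ Q≡S → ⊂-irref Q≡S Q⊂S) , incomparable⇒≢ R∥S ,
  P⊂R , Q⊂R , Q⊂S , P∥Q , P∥S , R∥S

induced⇒copy : ∀ {P Q R S : Subset n} → InducedN P Q R S → IsNCopy (lookup (P ∷ Q ∷ R ∷ S ∷ []))
induced⇒copy (_ , _ , _ , _ , _ , _ , P⊂R , Q⊂R , Q⊂S , (P⊈Q , Q⊈P) , (P⊈S , S⊈P) , (R⊈S , S⊈R)) =
  λ where
    0F 0F → holds ⊆-refl
    0F 1F → fails P⊈Q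
    0F 2F → holds (proj₁ P⊂R)
    0F 3F → fails P⊈S
    1F 0F → fails Q⊈P
    1F 1F → holds ⊆-refl
    1F 2F → holds (proj₁ Q⊂R)
    1F 3F → holds (proj₁ Q⊂S)
    2F 0F → fails (⊂⇒⊉ P⊂R)
    2F 1F → fails (⊂⇒⊉ Q⊂R)
    2F 2F → holds ⊆-refl
    2F 3F → fails R⊈S
    3F 0F → fails S⊈P
    3F 1F → fails (⊂⇒⊉ Q⊂S)
    3F 2F → fails S⊈R
    3F 3F → holds ⊆-refl
  where
  holds : p ⊆ q → p ⊆ q ⇔ T true
  holds p⊆q = mk⇔ _ λ _ {x} → p⊆q {x}
  fails : ¬ (p ⊆ q) → p ⊆ q ⇔ T false
  fails p⊈q = mk⇔ p⊈q λ ()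

module _ {v : Fin 4 → Subset n} (copy : IsNCopy v) where

  copy-strict : ∀ {i j} → T (i ≤ᴺ j) → ¬ T (j ≤ᴺ i) → v i ⊂ v j
  copy-strict {i} {j} i≤j j≰i = ⊆∧⊉⇒⊂ (from (copy i j) i≤j) (j≰i ∘ to (copy j i))

  copy-incomparable : ∀ {i j} → ¬ T (i ≤ᴺ j) → ¬ T (j ≤ᴺ i) → Incomparable (v i) (v j)
  copy-incomparable {i} {j} i≰j j≰i = i≰j ∘ to (copy i j) , j≰i ∘ to (copy j i)

  copy-injective : ∀ {i j} → v i ≡ v j → i ≡ j
  copy-injective {i} {j} vi≡vj =
    ≤ᴺ-antisym i j (to (copy i j) (⊆-reflexive vi≡vj)) (to (copy j i) (⊆-reflexive (sym vi≡vj)))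

  copy⇒induced : InducedN (v 0F) (v 1F) (v 2F) (v 3F)
  copy⇒induced =
    induced-N (copy-strict _ λ ()) (copy-strict _ λ ()) (copy-strict _ λ ())
              (copy-incomparable (λ ()) (λ ())) (copy-incomparable (λ ()) (λ ()))
              (copy-incomparable (λ ()) (λ ()))

  copy-≤ᴺ-≡ : ∀ {i j k l} → (v i ⊆ v j ⇔ v k ⊆ v l) → i ≤ᴺ j ≡ k ≤ᴺ l
  copy-≤ᴺ-≡ {i} {j} {k} {l} e = does-⇔ (copy k l ⇔-∘ (e ⇔-∘ ⇔-sym (copy i j))) (T? _) (T? _)

  copy-twin-free : ∀ {i j} → i ≢ j → ∃ λ k → k ≢ i × k ≢ j × ¬ Indiscernible (v k) (v i) (v j)
  copy-twin-free {i} {j} i≢j with ≤ᴺ-twin-free i j i≢j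
  ... | k , k≢i , k≢j , inj₁ below≢ = k , k≢i , k≢j , below≢ ∘ copy-≤ᴺ-≡ ∘ proj₁
  ... | k , k≢i , k≢j , inj₂ above≢ = k , k≢i , k≢j , above≢ ∘ copy-≤ᴺ-≡ ∘ proj₂

containsN⇒copy : ∀ {F : Family n} → ContainsInducedN F → NCopyIn F
containsN⇒copy (P , Q , R , S , P∈F , Q∈F , R∈F , S∈F , N) =
  lookup (P ∷ Q ∷ R ∷ S ∷ []) , induced⇒copy N , λ where
    0F → P∈F
    1F → Q∈F
    2F → R∈F
    3F → S∈F

copy⇒containsN : ∀ {F : Family n} → NCopyIn F → ContainsInducedN F
copy⇒containsN (v , copy , v∈F) =
  v 0F , v 1F , v 2F , v 3F , v∈F 0F , v∈F 1F , v∈F 2F , v∈F 3F , copy⇒induced copy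

copy-avoids-comparable : ∀ {v : Fin 4 → Subset n} → IsNCopy v →
  (∀ Z → Z ⊆ X ⊎ X ⊆ Z) → ∀ i → v i ≢ X
copy-avoids-comparable {v = v} copy comparable i refl with ≤ᴺ-incomparable i
... | j , i≰j , j≰i with comparable (v j)
...   | inj₁ vj⊆vi = j≰i (to (copy j i) vj⊆vi)
...   | inj₂ vi⊆vj = i≰j (to (copy i j) vi⊆vj)

-- Twins

Twins : Family n → Subset n → Subset n → Set
Twins F A X = ∀ {Z} → Z ∈ₗ F → Z ≢ A → Indiscernible Z X A

module _ {F : Family n} {v : Fin 4 → Subset n} (copy : IsNCopy v)
         {x : Fin 4} (v∈ : ∀ i → v i ∈ₗ v x ∷F F) where

  others∈F : ∀ i → i ≢ x → v i ∈ₗ F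
  others∈F i i≢x = Any.tail (i≢x ∘ copy-injective copy) (v∈ i)

  copy-has-no-twins : ∀ {a} → a ≢ x → ¬ Twins F (v a) (v x)
  copy-has-no-twins a≢x twins with copy-twin-free copy (a≢x ∘ sym)
  ... | k , k≢x , k≢a , separated = separated (twins (others∈F k k≢x) (k≢a ∘ copy-injective copy))

  copy-replace-twin : A ∈ₗ F → (∀ i → v i ≢ A) → Twins F A (v x) → NCopyIn F
  copy-replace-twin {A = A} A∈F A∉v twins = w , (λ i j → copy i j ⇔-∘ w≈v i j) , w∈F
    where
    w : Fin 4 → Subset _
    w i with i ≟ x
    ... | yes _ = A
    ... | no _ = v i
    w∈F : ∀ i → w i ∈ₗ F
    w∈F i with i ≟ x
    ... | yes _ = A∈F
    ... | no i≢x = others∈F i i≢x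
    w≈v : ∀ i j → w i ⊆ w j ⇔ v i ⊆ v j
    w≈v i j with i ≟ x | j ≟ x
    ... | yes refl | yes refl = mk⇔ (λ _ {_} y∈ → y∈) (λ _ {_} y∈ → y∈)
    ... | yes refl | no j≢x = ⇔-sym (proj₂ (twins (others∈F j j≢x) (A∉v j)))
    ... | no i≢x | yes refl = ⇔-sym (proj₁ (twins (others∈F i i≢x) (A∉v i)))
    ... | no _ | no _ = ⇔-id _

twin-copy : ∀ {F : Family n} → A ∈ₗ F → X ≢ A → Twins F A X → NCopyIn (X ∷F F) → NCopyIn F
twin-copy {A = A} {X = X} A∈F X≢A twins (v , copy , v∈) with Fin.any? (λ i → v i ≟ₛ X)
... | no X∉v = v , copy , λ i → Any.tail (X∉v ∘ (i ,_)) (v∈ i)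
... | yes (x , refl) with Fin.any? (λ i → v i ≟ₛ A)
...   | yes (a , refl) = ⊥-elim (copy-has-no-twins copy v∈ (X≢A ∘ sym ∘ cong v) twins)
...   | no A∉v = copy-replace-twin copy v∈ A∈F (λ i → A∉v ∘ (i ,_)) twins

Separates : Subset n → Subset n → Subset n → Set
Separates Z X Y = (Z ⊆ X × ¬ Z ⊆ Y) ⊎ (Z ⊆ Y × ¬ Z ⊆ X) ⊎ (X ⊆ Z × ¬ Y ⊆ Z) ⊎ (Y ⊆ Z × ¬ X ⊆ Z)

separates? : ∀ (Z X Y : Subset n) → Dec (Separates Z X Y)
separates? Z X Y =
  (Z ⊆? X ×-dec ¬? (Z ⊆? Y)) ⊎-dec (Z ⊆? Y ×-dec ¬? (Z ⊆? X)) ⊎-dec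
  (X ⊆? Z ×-dec ¬? (Y ⊆? Z)) ⊎-dec (Y ⊆? Z ×-dec ¬? (X ⊆? Z))

¬separates⇒indiscernible : ∀ {Y : Subset n} → ¬ Separates Z X Y → Indiscernible Z X Y
¬separates⇒indiscernible {Z = Z} {X = X} {Y = Y} ¬sep = mk⇔ below-X below-Y , mk⇔ above-X above-Y
  where
  below-X : Z ⊆ X → Z ⊆ Y
  below-X Z⊆X = decidable-stable (Z ⊆? Y) λ Z⊈Y → ¬sep (inj₁ (Z⊆X , Z⊈Y))
  below-Y : Z ⊆ Y → Z ⊆ X
  below-Y Z⊆Y = decidable-stable (Z ⊆? X) λ Z⊈X → ¬sep (inj₂ (inj₁ (Z⊆Y , Z⊈X)))
  above-X : X ⊆ Z → Y ⊆ Z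
  above-X X⊆Z = decidable-stable (Y ⊆? Z) λ Y⊈Z → ¬sep (inj₂ (inj₂ (inj₁ (X⊆Z , Y⊈Z))))
  above-Y : Y ⊆ Z → X ⊆ Z
  above-Y Y⊆Z = decidable-stable (X ⊆? Z) λ X⊈Z → ¬sep (inj₂ (inj₂ (inj₂ (Y⊆Z , X⊈Z))))

-- Saturated families

data Position : Set where
  below notAbove : Position

Slot : ℕ → Set
Slot n = Subset n × Position

module Saturated {F : Family n} (saturated : NSaturated F) where

  N-free : ¬ ContainsInducedN F
  N-free = proj₁ saturated

  ∈-by-saturation : (NCopyIn (X ∷F F) → NCopyIn F) → X ∈ₗ F
  ∈-by-saturation {X = X} reduce with Any.any? (X ≟ₛ_) F
  ... | yes X∈F = X∈F
  ... | no X∉F = ⊥-elim (N-free (copy⇒containsN (reduce (containsN⇒copy (proj₂ saturated X X∉F)))))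

  comparable∈F : (∀ Z → Z ⊆ X ⊎ X ⊆ Z) → X ∈ₗ F
  comparable∈F comparable = ∈-by-saturation λ (v , copy , v∈) →
    v , copy , λ i → Any.tail (copy-avoids-comparable copy comparable i) (v∈ i)

  ⊥∈F : ⊥ ∈ₗ F
  ⊥∈F = comparable∈F λ _ → inj₂ ⊥⊆

  ⊤∈F : ⊤ ∈ₗ F
  ⊤∈F = comparable∈F λ _ → inj₁ ⊆⊤

  separator : A ∈ₗ F → X ∉ₗ F → X ≢ A → ∃ λ Z → Z ∈ₗ F × Z ≢ A × Separates Z X A
  separator {A = A} {X = X} A∈F X∉F X≢A with Any.any? (λ Z → ¬? (Z ≟ₛ A) ×-dec separates? Z X A) F
  ... | yes separating = let Z , Z∈F , Z≢A , sep = find separating in Z , Z∈F , Z≢A , sep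
  ... | no none = ⊥-elim (X∉F (∈-by-saturation (twin-copy A∈F X≢A twins)))
    where
    twins : Twins F A X
    twins Z∈F Z≢A = ¬separates⇒indiscernible λ sep → none (lose Z∈F (Z≢A , sep))

  record _⋖_ (A C : Subset n) : Set where
    field
      lower∈F : A ∈ₗ F
      upper∈F : C ∈ₗ F
      lower⊂upper : A ⊂ C
      nothing-between : ∀ {Z} → Z ∈ₗ F → ¬ (A ⊂ Z × Z ⊂ C)

  Witness : Subset n → Slot n → Set
  Witness C (Z , below)    = Z ∈ₗ F × Nonempty Z × Z ⊆ C
  Witness C (Z , notAbove) = Z ∈ₗ F × Nonempty Z × ¬ C ⊆ Z

  Fresh : Subset n → Subset n → Fin n → Slot n → Set
  Fresh A C j (Z , below)    = Z ∈ₗ F × Z ⊆ C × j ∈ Z × (∀ {x} → x ∈ Z → x ∉ A → x ≡ j)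
  Fresh A C j (Z , notAbove) = Z ∈ₗ F × Nonempty Z × A ⊆ Z × j ∉ Z × (∀ {x} → x ∈ C → x ≢ j → x ∈ Z)

  module _ {A C} (cover : A ⋖ C) where
    open _⋖_ cover

    cover-induces-N : ∀ {G Z} → A ⊂ G → Incomparable G C → j ∉ G →
      Z ∈ₗ F → Z ⊂ C → j ∈ Z → j ∉ A → InducedN Z A C G
    cover-induces-N {j = j} {G = G} {Z = Z} A⊂G (G⊈C , C⊈G) j∉G Z∈F Z⊂C j∈Z j∉A =
      induced-N Z⊂C lower⊂upper A⊂G (Z⊈A , A⊈Z) (Z⊈G , G⊈Z) (C⊈G , G⊈C)
      where
      Z⊈A : ¬ Z ⊆ A
      Z⊈A Z⊆A = j∉A (Z⊆A j∈Z)
      A⊈Z : ¬ A ⊆ Z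
      A⊈Z A⊆Z = nothing-between Z∈F (⊆∧⊉⇒⊂ A⊆Z Z⊈A , Z⊂C)
      Z⊈G : ¬ Z ⊆ G
      Z⊈G Z⊆G = j∉G (Z⊆G j∈Z)
      G⊈Z : ¬ G ⊆ Z
      G⊈Z G⊆Z = G⊈C (⊆-trans G⊆Z (proj₁ Z⊂C))

    fresh-below : j ∈ C → j ∉ A → k ∈ C → k ∉ A → k ≢ j →
      ¬ Any (λ G → A ⊂ G × Incomparable G C × j ∉ G) F → ∃ (Fresh A C j)
    fresh-below {j = j} {k = k} j∈C j∉A k∈C k∉A k≢j no-G = analyse (separator lower∈F A∪j∉F A∪j≢A)
      where
      A∪j : Subset n
      A∪j = A ∪ ⁅ j ⁆
      j∈A∪j : j ∈ A∪j
      j∈A∪j = x∈p∪q⁺ (inj₂ (x∈⁅x⁆ j))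
      A⊆A∪j : A ⊆ A∪j
      A⊆A∪j = p⊆p∪q ⁅ j ⁆
      A∪j⊆C : A∪j ⊆ C
      A∪j⊆C = p⊆q∧x∈q⇒p∪⁅x⁆⊆q (proj₁ lower⊂upper) j∈C
      A∪j≢A : A∪j ≢ A
      A∪j≢A A∪j≡A = j∉A (subst (j ∈_) A∪j≡A j∈A∪j)
      A∪j∉F : A∪j ∉ₗ F
      A∪j∉F A∪j∈F = nothing-between A∪j∈F
        ((A⊆A∪j , j , j∈A∪j , j∉A) , (A∪j⊆C , k , k∈C , [ k∉A , k≢j ] ∘ x∈p∪⁅y⁆⇒x∈p⊎x≡y))
      analyse : (∃ λ Z → Z ∈ₗ F × Z ≢ A × Separates Z A∪j A) → ∃ (Fresh A C j)
      analyse (Z , Z∈F , _ , inj₁ (Z⊆A∪j , Z⊈A)) =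
        (Z , below) , Z∈F , ⊆-trans Z⊆A∪j A∪j⊆C , j∈Z , only-j
        where
        only-j : ∀ {x} → x ∈ Z → x ∉ A → x ≡ j
        only-j x∈Z x∉A = [ (λ x∈A → contradiction x∈A x∉A) , (λ x≡j → x≡j) ]
                           (x∈p∪⁅y⁆⇒x∈p⊎x≡y (Z⊆A∪j x∈Z))
        j∈Z : j ∈ Z
        j∈Z = let x , x∈Z , x∉A = ⊈⇒∃∉ Z⊈A in subst (_∈ Z) (only-j x∈Z x∉A) x∈Z
      analyse (_ , _ , _ , inj₂ (inj₁ (Z⊆A , Z⊈A∪j))) = ⊥-elim (Z⊈A∪j (⊆-trans Z⊆A A⊆A∪j))
      analyse (_ , _ , _ , inj₂ (inj₂ (inj₁ (A∪j⊆Z , A⊈Z)))) = ⊥-elim (A⊈Z (⊆-trans A⊆A∪j A∪j⊆Z))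
      analyse (Z , Z∈F , Z≢A , inj₂ (inj₂ (inj₂ (A⊆Z , A∪j⊈Z)))) =
        ⊥-elim (no-G (lose Z∈F (A⊂Z , (Z⊈C , C⊈Z) , j∉Z)))
        where
        j∉Z : j ∉ Z
        j∉Z = A∪j⊈Z ∘ p⊆q∧x∈q⇒p∪⁅x⁆⊆q A⊆Z
        A⊂Z : A ⊂ Z
        A⊂Z = ⊆∧≢⇒⊂ A⊆Z (Z≢A ∘ sym)
        C⊈Z : ¬ C ⊆ Z
        C⊈Z C⊆Z = j∉Z (C⊆Z j∈C)
        Z⊈C : ¬ Z ⊆ C
        Z⊈C Z⊆C = nothing-between Z∈F (A⊂Z , ⊆∧⊉⇒⊂ Z⊆C C⊈Z)

    fresh-notAbove : ∀ {G} → j ∈ C → j ∉ A → k ∈ C → k ∉ A → k ≢ j →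
      G ∈ₗ F → A ⊂ G → Incomparable G C → j ∉ G → ∃ (Fresh A C j)
    fresh-notAbove {j = j} {k = k} {G = G} j∈C j∉A k∈C k∉A k≢j G∈F A⊂G G∥C j∉G =
      analyse (separator upper∈F C-j∉F C-j≢C)
      where
      C-j⊆C : C - j ⊆ C
      C-j⊆C = p─q⊆p C ⁅ j ⁆
      A⊆C-j : A ⊆ C - j
      A⊆C-j = p⊆q∧x∉p⇒p⊆q-x (proj₁ lower⊂upper) j∉A
      k∈C-j : k ∈ C - j
      k∈C-j = x∈p∧x≢y⇒x∈p-y k∈C k≢j
      C-j≢C : C - j ≢ C
      C-j≢C C-j≡C = x∉p-x j (subst (j ∈_) (sym C-j≡C) j∈C)
      C-j∉F : C - j ∉ₗ F
      C-j∉F C-j∈F = nothing-between C-j∈F ((A⊆C-j , k , k∈C-j , k∉A) , (C-j⊆C , j , j∈C , x∉p-x j))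
      analyse : (∃ λ Z → Z ∈ₗ F × Z ≢ C × Separates Z (C - j) C) → ∃ (Fresh A C j)
      analyse (_ , _ , _ , inj₁ (Z⊆C-j , Z⊈C)) = ⊥-elim (Z⊈C (⊆-trans Z⊆C-j C-j⊆C))
      analyse (Z , Z∈F , Z≢C , inj₂ (inj₁ (Z⊆C , Z⊈C-j))) =
        ⊥-elim (N-free (Z , A , C , G , Z∈F , lower∈F , upper∈F , G∈F ,
                        cover-induces-N A⊂G G∥C j∉G Z∈F (⊆∧≢⇒⊂ Z⊆C Z≢C) j∈Z j∉A))
        where
        j∈Z : j ∈ Z
        j∈Z = decidable-stable (j ∈? Z) (Z⊈C-j ∘ p⊆q∧x∉p⇒p⊆q-x Z⊆C)
      analyse (Z , Z∈F , _ , inj₂ (inj₂ (inj₁ (C-j⊆Z , C⊈Z)))) =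
        (Z , notAbove) , Z∈F , (k , C-j⊆Z k∈C-j) , ⊆-trans A⊆C-j C-j⊆Z , C⊈Z ∘ p-x⊆q∧x∈q⇒p⊆q C-j⊆Z ,
        λ x∈C x≢j → C-j⊆Z (x∈p∧x≢y⇒x∈p-y x∈C x≢j)
      analyse (_ , _ , _ , inj₂ (inj₂ (inj₂ (C⊆Z , C-j⊈Z)))) = ⊥-elim (C-j⊈Z (⊆-trans C-j⊆C C⊆Z))

    fresh : j ∈ C → j ∉ A → ∃ (Fresh A C j)
    fresh {j = j} j∈C j∉A with Fin.any? (λ k → k ∈? C ×-dec ¬? (k ∈? A) ×-dec ¬? (k ≟ j))
    ... | no no-other = (C , below) , upper∈F , ⊆-refl , j∈C , only-j
      where
      only-j : ∀ {x} → x ∈ C → x ∉ A → x ≡ j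
      only-j {x} x∈C x∉A = decidable-stable (x ≟ j) λ x≢j → no-other (x , x∈C , x∉A , x≢j)
    ... | yes (k , k∈C , k∉A , k≢j)
      with Any.any? (λ G → A ⊂? G ×-dec (¬? (G ⊆? C) ×-dec ¬? (C ⊆? G)) ×-dec ¬? (j ∈? G)) F
    ...   | no no-G = fresh-below j∈C j∉A k∈C k∉A k≢j no-G
    ...   | yes some-G = let G , G∈F , A⊂G , G∥C , j∉G = find some-G in
                         fresh-notAbove j∈C j∉A k∈C k∉A k≢j G∈F A⊂G G∥C j∉G

  witness-mono : ∀ {s} → A ⊆ C → Witness A s → Witness C s
  witness-mono {s = Z , below}    A⊆C (Z∈F , nonempty , Z⊆A) = Z∈F , nonempty , ⊆-trans Z⊆A A⊆C
  witness-mono {s = Z , notAbove} A⊆C (Z∈F , nonempty , A⊈Z) = Z∈F , nonempty , A⊈Z ∘ ⊆-trans A⊆C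

  fresh⇒witness : ∀ {s} → j ∈ C → Fresh A C j s → Witness C s
  fresh⇒witness {s = Z , below}    _   (Z∈F , Z⊆C , j∈Z , _)          = Z∈F , (_ , j∈Z) , Z⊆C
  fresh⇒witness {s = Z , notAbove} j∈C (Z∈F , nonempty , _ , j∉Z , _) =
    Z∈F , nonempty , λ C⊆Z → j∉Z (C⊆Z j∈C)

  witness-not-fresh : ∀ {s} → j ∉ A → Witness A s → ¬ Fresh A C j s
  witness-not-fresh {s = Z , below}    j∉A (_ , _ , Z⊆A) (_ , _ , j∈Z , _) = j∉A (Z⊆A j∈Z)
  witness-not-fresh {s = Z , notAbove} _   (_ , _ , A⊈Z) (_ , _ , A⊆Z , _) = A⊈Z A⊆Z

  fresh-injective : ∀ {i s} → i ∈ C → j ∉ A → Fresh A C i s → Fresh A C j s → i ≡ j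
  fresh-injective {s = Z , below} _ j∉A (_ , _ , _ , only-i) (_ , _ , j∈Z , _) =
    sym (only-i j∈Z j∉A)
  fresh-injective {j = j} {i = i} {s = Z , notAbove} i∈C _
                  (_ , _ , _ , i∉Z , _) (_ , _ , _ , _ , all-but-j) =
    decidable-stable (i ≟ j) λ i≢j → i∉Z (all-but-j i∈C i≢j)

  record Assignment (C : Subset n) : Set where
    field
      slot      : ∀ {j} → j ∈ C → Slot n
      witness   : ∀ {j} (j∈C : j ∈ C) → Witness C (slot j∈C)
      injective : ∀ {i j} (i∈C : i ∈ C) (j∈C : j ∈ C) → slot i∈C ≡ slot j∈C → i ≡ j

  empty-assignment : Empty C → Assignment C
  empty-assignment empty = record
    { slot = λ j∈C → ⊥-elim (empty (_ , j∈C))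
    ; witness = λ j∈C → ⊥-elim (empty (_ , j∈C))
    ; injective = λ i∈C _ _ → ⊥-elim (empty (_ , i∈C))
    }

  extend : A ⋖ C → Assignment A → Assignment C
  extend {A = A} {C = C} cover old = record
    { slot = λ {j} j∈C → slot′ j∈C (j ∈? A)
    ; witness = λ {j} j∈C → witness′ j∈C (j ∈? A)
    ; injective = λ {i} {j} i∈C j∈C → injective′ i∈C j∈C (i ∈? A) (j ∈? A)
    }
    where
    module Old = Assignment old
    A⊆C : A ⊆ C
    A⊆C = proj₁ (_⋖_.lower⊂upper cover)
    new : (j∈C : j ∈ C) (j∉A : j ∉ A) → Fresh A C j (proj₁ (fresh cover j∈C j∉A))
    new j∈C j∉A = proj₂ (fresh cover j∈C j∉A)
    slot′ : j ∈ C → Dec (j ∈ A) → Slot n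
    slot′ _   (yes j∈A) = Old.slot j∈A
    slot′ j∈C (no j∉A)  = proj₁ (fresh cover j∈C j∉A)
    witness′ : (j∈C : j ∈ C) (j∈?A : Dec (j ∈ A)) → Witness C (slot′ j∈C j∈?A)
    witness′ _   (yes j∈A) = witness-mono A⊆C (Old.witness j∈A)
    witness′ j∈C (no j∉A)  = fresh⇒witness j∈C (new j∈C j∉A)
    injective′ : ∀ {i j} (i∈C : i ∈ C) (j∈C : j ∈ C) (i∈?A : Dec (i ∈ A)) (j∈?A : Dec (j ∈ A)) →
      slot′ i∈C i∈?A ≡ slot′ j∈C j∈?A → i ≡ j
    injective′ _ _ (yes i∈A) (yes j∈A) = Old.injective i∈A j∈A
    injective′ _ j∈C (yes i∈A) (no j∉A) eq =
      ⊥-elim (witness-not-fresh j∉A (subst (Witness A) eq (Old.witness i∈A)) (new j∈C j∉A))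
    injective′ i∈C _ (no i∉A) (yes j∈A) eq =
      ⊥-elim (witness-not-fresh i∉A (subst (Witness A) (sym eq) (Old.witness j∈A)) (new i∈C i∉A))
    injective′ i∈C j∈C (no i∉A) (no j∉A) eq =
      fresh-injective i∈C j∉A (new i∈C i∉A) (subst (Fresh A C _) (sym eq) (new j∈C j∉A))

  assignment : C ∈ₗ F → Assignment C
  assignment = build (⊂-wellFounded _)
    where
    build : Acc _⊂_ C → C ∈ₗ F → Assignment C
    build {C = C} (acc smaller) C∈F with nonempty? C
    ... | no empty = empty-assignment empty
    ... | yes (x , x∈C) with lower-cover F (⊥⊆ , x , x∈C , ∉⊥)
    ...   | B , B∈ , B⊂C , nothing-between = extend cover (build (smaller B⊂C) B∈F)
      where
      B∈F : B ∈ₗ F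
      B∈F = [ (λ { refl → ⊥∈F }) , (λ B∈F → B∈F) ] B∈
      cover : B ⋖ C
      cover = record
        { lower∈F = B∈F ; upper∈F = C∈F ; lower⊂upper = B⊂C ; nothing-between = nothing-between }

  slots : List (Slot n)
  slots = cartesianProduct (filter nonempty? F) (below ∷ notAbove ∷ [])

  witness∈slots : ∀ {s} → Witness C s → s ∈ₗ slots
  witness∈slots {s = _ , below} (Z∈F , nonempty , _) =
    ∈-cartesianProduct⁺ (∈-filter⁺ nonempty? Z∈F nonempty) (here refl)
  witness∈slots {s = _ , notAbove} (Z∈F , nonempty , _) =
    ∈-cartesianProduct⁺ (∈-filter⁺ nonempty? Z∈F nonempty) (there (here refl))

  n≤|nonempty|*2 : n ≤ length (filter nonempty? F) * 2
  n≤|nonempty|*2 =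
    subst (n ≤_) (length-cartesianProduct (filter nonempty? F) (below ∷ notAbove ∷ []))
          (injective⇒≤-length slot⊤ (injective ∈⊤ ∈⊤) λ _ → witness∈slots (witness ∈⊤))
    where
    open Assignment (assignment ⊤∈F)
    slot⊤ : Fin n → Slot n
    slot⊤ j = slot (∈⊤ {x = j})

  |nonempty|<|F| : length (filter nonempty? F) < length F
  |nonempty|<|F| = filter-notAll nonempty? F (lose ⊥∈F λ (_ , x∈⊥) → ∉⊥ x∈⊥)

n+6≤4m : ∀ {n f m} → 1 ≤ n → n ≤ f * 2 → f < m → n + 6 ≤ 4 * m
n+6≤4m {f = zero} 1≤n n≤0 _ = contradiction (≤-trans 1≤n n≤0) λ ()
n+6≤4m {n} {suc f} {m} _ n≤2f f<m = begin
  n + 6                  ≤⟨ +-monoˡ-≤ 6 n≤2f ⟩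
  suc f * 2 + 6          ≤⟨ m≤m+n (suc f * 2 + 6) (f * 2) ⟩
  suc f * 2 + 6 + f * 2  ≡⟨ solve 1 (λ f → (con 1 :+ f) :* con 2 :+ con 6 :+ f :* con 2
                                            := con 4 :* (con 2 :+ f)) refl f ⟩
  4 * suc (suc f)        ≤⟨ *-monoʳ-≤ 4 f<m ⟩
  4 * m                  ∎
  where open ≤-Reasoning

theorem4p2 : (n : ℕ) → 1 ≤ n → (F : Family n) → Unique F → NSaturated F →
    n + 6 ≤ 4 * length F
theorem4p2 n 1≤n F _ saturated =
  n+6≤4m 1≤n n≤|nonempty|*2 |nonempty|<|F|
  where open Saturated saturated
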